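{- Let $G$ be a graph and let $M$ be a matching in $G$, with every edge of $M$ having one endpoint in $U$ and the other in $W$ (so $U\cup W$ is the set of vertices covered by $M$). Suppose that every vertex $w\in W$ has exactly one neighbor in $G$ among the vertices covered by $M$. Let $k\geq 0$ and assume that $|N_G(U)\setminus (W\cup N_G(W))|\geq k$. Then $f_o(G)\geq \frac{k}{4}$.
   Context: All graphs are finite and simple. For a set $S$ of vertices, $N_G(S)=\bigcup_{s\in S}N_G(s)$ is the union of the neighborhoods of its vertices. For a graph $G$, $f_o(G)=\max\{|V_0| : V_0\subseteq V(G),\ G[V_0]\text{ has all degrees odd}\}$, where $G[V_0]$ denotes the induced subgraph on $V_0$. -}

module Defs where

open import Data.Nat using (ℕ; zero; suc; _+_; _%_; _≡ᵇ_; _⊔_)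
open import Data.Bool using (Bool; true; false; _∧_; _∨_; T)
open import Data.Fin using (Fin)
open import Data.Fin.Subset using (Subset; _∈_; _∪_; _∩_; ∣_∣)
open import Data.Vec using (Vec; []; _∷_; tabulate; lookup)
open import Data.List using (List; []; _∷_; map; foldr; concatMap; _++_; allFin)
open import Data.Product using (_×_; _,_; proj₁; proj₂)
open import Relation.Binary.PropositionalEquality using (_≡_)

record Graph (n : ℕ) : Set where
  field
    adj   : Fin n → Fin n → Bool
    sym   : ∀ u v → adj u v ≡ adj v u
    irrfl : ∀ v → adj v v ≡ false
open Graph public

Adj : ∀ {n} → Graph n → Fin n → Fin n → Set
Adj G u v = T (adj G u v)

Nv : ∀ {n} → Graph n → Fin n → Subset n
Nv G v = tabulate (λ u → adj G v u)

N : ∀ {n} → Graph n → Subset n → Subset n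
N {n} G S = tabulate (λ v → foldr (λ s b → (lookup S s ∧ adj G s v) ∨ b) false (allFin n))

_∖_ : ∀ {n} → Subset n → Subset n → Subset n
[] ∖ [] = []
(a ∷ A) ∖ (b ∷ B) = (a ∧ Data.Bool.not b) ∷ (A ∖ B)

degIn : ∀ {n} → Graph n → Subset n → Fin n → ℕ
degIn G V0 v = ∣ V0 ∩ Nv G v ∣

allOddB : ∀ {n} → Graph n → Subset n → Bool
allOddB {n} G V0 =
  foldr (λ v b → (Data.Bool.not (lookup V0 v) ∨ (degIn G V0 v % 2 ≡ᵇ 1)) ∧ b) true (allFin n)

allSubsets : (n : ℕ) → List (Subset n)
allSubsets zero = [] ∷ []
allSubsets (suc n) = map (true ∷_) (allSubsets n) ++ map (false ∷_) (allSubsets n)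

-- f_o(G) = max { |V0| : G[V0] has all degrees odd }  (the empty set qualifies)
fo : ∀ {n} → Graph n → ℕ
fo {n} G = foldr (λ V0 m → (if allOddB G V0 then ∣ V0 ∣ else 0) ⊔ m) 0 (allSubsets n)
  where open import Data.Bool using (if_then_else_)

endpoints : ∀ {n} → List (Fin n × Fin n) → List (Fin n)
endpoints = concatMap (λ e → proj₁ e ∷ proj₂ e ∷ [])

-- M is a matching in G (each element an edge, all endpoints pairwise distinct)
-- each pair (u , w) is oriented: u is its U-endpoint, w its W-endpoint
open import Data.List.Relation.Unary.All using (All)
open import Data.List.Relation.Unary.Unique.Propositional using (Unique)
open import Data.List.Membership.Propositional using () renaming (_∈_ to _∈ₗ_)
open import Data.Product using (∃)

record IsMatching {n} (G : Graph n) (M : List (Fin n × Fin n)) : Set where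
  field
    edges    : All (λ e → Adj G (proj₁ e) (proj₂ e)) M
    disjoint : Unique (endpoints M)

-- Let X = N(U) ∖ (W ∪ N(W)); every x ∈ X has a neighbour in U, and none in W.
-- Toggling a vertex u in a set T ⊆ U flips the parity of |N(x) ∩ T| exactly for the
-- neighbours x of u, so by induction over U some T gives at least half of X an odd number of
-- neighbours in T. By Gallai's theorem (proved by local complementation at a vertex of odd
-- degree) these vertices split into two parts each inducing a graph with all degrees even;
-- the larger part A has |A| ≥ |X|/4. In G[T ∪ A] every vertex of A has odd degree, and each
-- u ∈ T of even degree is repaired by adding its partner w ∈ W, whose only neighbour in
-- T ∪ A ∪ W is u. The resulting set induces a graph with all degrees odd and contains A.

module Submission where

open import Defs hiding (sym)
open import Algebra.Bundles using (CommutativeRing; CommutativeMonoid)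
open import Data.Bool using (Bool; true; false; _∧_; _∨_; not; _xor_; if_then_else_)
open import Data.Bool.Properties
  using ( xor-comm; xor-assoc; xor-identityʳ; xor-inverseʳ; xor-same; xor-∧-commutativeRing
        ; ∧-identityʳ; ∧-zeroʳ; ∧-comm; ∧-assoc; ∧-idem; ∧-inverseʳ; ∧-distribʳ-xor; ∧-distribˡ-xor
        ; ∧-commutativeMonoid; ∨-zeroʳ; ¬-not; T-≡ )
  renaming (_≟_ to _≟𝔹_)
open import Data.Empty using (⊥; ⊥-elim)
open import Data.Fin using (Fin; zero; suc; _≟_)
open import Data.Fin.Properties using (any?)
open import Data.Fin.Subset using (Subset; _∈_; _∪_; _∩_; ∣_∣)
open import Data.List using (List; []; _∷_; allFin; foldr; map; filter)
open import Data.List.Membership.Propositional using () renaming (_∈_ to _∈ₗ_)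
open import Data.List.Membership.Propositional.Properties
  using (∈-allFin; ∈-filter⁺; ∈-filter⁻; ∈-++⁺ˡ; ∈-++⁺ʳ; ∈-map⁺)
open import Data.List.Relation.Unary.All using (_∷_) renaming (lookup to All-lookup)
open import Data.List.Relation.Unary.AllPairs using (_∷_)
open import Data.List.Relation.Unary.Any using (here; there)
open import Data.List.Relation.Unary.Unique.Propositional using (Unique)
open import Data.Nat using (ℕ; zero; suc; _+_; _*_; _%_; _≡ᵇ_; _⊔_; _≤_; _<_; z≤n; s≤s)
open import Data.Nat.DivMod using ([m+n]%n≡m%n)
open import Data.Nat.Induction using (<-wellFounded)
open import Data.Nat.Properties
  using ( +-comm; +-suc; +-mono-≤; +-monoʳ-≤; *-distribˡ-+; *-assoc; *-monoʳ-≤; ≤-total; ≤-trans; ≤-reflexive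
        ; m≤m+n; m≤n⇒m≤1+n; m≤m⊔n; m≤n⊔m; suc-injective; 0≢1+n; module ≤-Reasoning )
open import Data.Product using (_×_; _,_; ∃; proj₁; proj₂)
open import Data.Sum using (_⊎_; inj₁; inj₂)
open import Data.Vec using ([]; _∷_; lookup; tabulate)
open import Data.Vec.Properties using (lookup∘tabulate; lookup-zipWith; []=⇒lookup; lookup⇒[]=)
open import Function using (_∘_; id; flip)
open import Function.Bundles using (_⇔_; Equivalence)
open import Induction.WellFounded using (Acc; acc)
open import Relation.Binary.PropositionalEquality
  using (_≡_; _≢_; refl; sym; trans; cong; cong₂; subst; subst₂; _≗_; module ≡-Reasoning)
open import Relation.Nullary using (does; yes; no; contradiction)
open import Relation.Nullary.Decidable using (dec-true; dec-false)

open import Algebra.Properties.CommutativeSemigroup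
  (CommutativeRing.+-commutativeSemigroup xor-∧-commutativeRing)
  using () renaming (interchange to xor-interchange; xy∙z≈xz∙y to xor-xy∙z≈xz∙y)
open import Algebra.Properties.CommutativeSemigroup
  (CommutativeMonoid.commutativeSemigroup ∧-commutativeMonoid)
  using () renaming (x∙yz≈y∙xz to ∧-x∙yz≈y∙xz)

private variable m n : ℕ

-- Subsets of Fin n as Boolean indicator functions

Ind : ℕ → Set
Ind n = Fin n → Bool

∅ᵇ : Ind n
∅ᵇ _ = false

-- 'does' rather than ⌊_⌋, so that ⁅ suc v ⁆ᵇ (suc y) reduces to ⁅ v ⁆ᵇ y.
⁅_⁆ᵇ : Fin n → Ind n
⁅ v ⁆ᵇ y = does (y ≟ v)

infixr 7 _∩ᵇ_
infixr 7 _·ᵇ_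
infixr 6 _⊕ᵇ_
infix  4 _⊆ᵇ_

_∩ᵇ_ : Ind n → Ind n → Ind n
(A ∩ᵇ B) y = A y ∧ B y

_⊕ᵇ_ : Ind n → Ind n → Ind n
(A ⊕ᵇ B) y = A y xor B y

_·ᵇ_ : Bool → Ind n → Ind n
(b ·ᵇ A) y = b ∧ A y

∁ᵇ : Ind n → Ind n
∁ᵇ A y = not (A y)

_⊆ᵇ_ : Ind n → Ind n → Set
A ⊆ᵇ B = ∀ y → A y ≡ true → B y ≡ true

Disjointᵇ : Ind n → Ind n → Set
Disjointᵇ A B = ∀ y → A y ≡ true → B y ≡ false

∧-trueˡ : ∀ {a b} → a ∧ b ≡ true → a ≡ true
∧-trueˡ {true} _ = refl

∧-trueʳ : ∀ {a b} → a ∧ b ≡ true → b ≡ true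
∧-trueʳ {true} ab = ab

not-true : ∀ {a} → not a ≡ true → a ≡ false
not-true {false} _ = refl

⁅⁆ᵇ-refl : (v : Fin n) → ⁅ v ⁆ᵇ v ≡ true
⁅⁆ᵇ-refl v = dec-true (v ≟ v) refl

⁅⁆ᵇ-false : {v y : Fin n} → y ≢ v → ⁅ v ⁆ᵇ y ≡ false
⁅⁆ᵇ-false {v = v} {y} = dec-false (y ≟ v)

⁅⁆ᵇ-sym : (v y : Fin n) → ⁅ v ⁆ᵇ y ≡ ⁅ y ⁆ᵇ v
⁅⁆ᵇ-sym v y with y ≟ v
... | yes refl = sym (⁅⁆ᵇ-refl y)
... | no  y≢v  = sym (⁅⁆ᵇ-false (y≢v ∘ sym))

⁅⁆ᵇ-true : {v y : Fin n} → ⁅ v ⁆ᵇ y ≡ true → y ≡ v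
⁅⁆ᵇ-true {v = v} {y} e with y ≟ v
... | yes y≡v = y≡v

count : Ind n → ℕ
count {zero}  A = 0
count {suc n} A = (if A zero then suc else id) (count (A ∘ suc))

parity : Ind n → Bool
parity {zero}  A = false
parity {suc n} A = A zero xor parity (A ∘ suc)

count-cong : {A B : Ind n} → A ≗ B → count A ≡ count B
count-cong {zero}  eq = refl
count-cong {suc n} eq = cong₂ (λ b c → (if b then suc else id) c) (eq zero) (count-cong (eq ∘ suc))

count-empty : (A : Ind n) → (∀ y → A y ≡ false) → count A ≡ 0
count-empty {zero}  A none = refl
count-empty {suc n} A none rewrite none zero = count-empty (A ∘ suc) (none ∘ suc)

count-split : (A B : Ind n) → count A ≡ count (A ∩ᵇ B) + count (A ∩ᵇ ∁ᵇ B)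
count-split {zero}  A B = refl
count-split {suc n} A B with A zero | B zero | count-split (A ∘ suc) (B ∘ suc)
... | true  | true  | eq = cong suc eq
... | true  | false | eq = trans (cong suc eq) (sym (+-suc _ _))
... | false | _     | eq = eq

count-mono : (A B : Ind n) → A ⊆ᵇ B → count A ≤ count B
count-mono {zero}  A B A⊆B = z≤n
count-mono {suc n} A B A⊆B with A zero in a0 | B zero in b0 | count-mono (A ∘ suc) (B ∘ suc) (A⊆B ∘ suc)
... | true  | true  | le = s≤s le
... | true  | false | le with () ← trans (sym (A⊆B zero a0)) b0
... | false | true  | le = m≤n⇒m≤1+n le
... | false | false | le = le

count-⊕ : (A B : Ind n) → Disjointᵇ A B → count (A ⊕ᵇ B) ≡ count A + count B
count-⊕ {zero}  A B disj = refl
count-⊕ {suc n} A B disj with A zero in a0 | B zero in b0 | count-⊕ (A ∘ suc) (B ∘ suc) (disj ∘ suc)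
... | true  | true  | eq with () ← trans (sym b0) (disj zero a0)
... | true  | false | eq = cong suc eq
... | false | true  | eq = trans (cong suc eq) (sym (+-suc _ _))
... | false | false | eq = eq

count-remove : (A : Ind n) (v : Fin n) → A v ≡ true → count A ≡ suc (count (A ⊕ᵇ ⁅ v ⁆ᵇ))
count-remove {suc n} A zero Av rewrite Av =
  cong suc (count-cong (λ y → sym (xor-identityʳ (A (suc y)))))
count-remove {suc n} A (suc v) Av rewrite xor-identityʳ (A zero) with A zero
... | true  = cong suc (count-remove (A ∘ suc) v Av)
... | false = count-remove (A ∘ suc) v Av

count-%2 : (A : Ind n) → (count A % 2 ≡ᵇ 1) ≡ parity A
count-%2 {zero}  A = refl
count-%2 {suc n} A with A zero
... | true  = trans (%2-suc (count (A ∘ suc))) (cong not (count-%2 (A ∘ suc)))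
  where
  %2-suc : ∀ c → (suc c % 2 ≡ᵇ 1) ≡ not (c % 2 ≡ᵇ 1)
  %2-suc zero          = refl
  %2-suc (suc zero)    = refl
  %2-suc (suc (suc c)) = begin
    (suc (suc (suc c)) % 2 ≡ᵇ 1) ≡⟨ cong (_≡ᵇ 1) (%2-+2 (suc c)) ⟩
    (suc c % 2 ≡ᵇ 1)             ≡⟨ %2-suc c ⟩
    not (c % 2 ≡ᵇ 1)             ≡⟨ cong (λ r → not (r ≡ᵇ 1)) (%2-+2 c) ⟨
    not (suc (suc c) % 2 ≡ᵇ 1)   ∎
    where
    open ≡-Reasoning
    %2-+2 : ∀ c → suc (suc c) % 2 ≡ c % 2
    %2-+2 c = trans (cong (_% 2) (+-comm 2 c)) ([m+n]%n≡m%n c 2)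
... | false = count-%2 (A ∘ suc)

≤-twice-larger : ∀ a b → a + b ≤ 2 * a ⊎ a + b ≤ 2 * b
≤-twice-larger a b with ≤-total b a
... | inj₁ b≤a = inj₁ (+-monoʳ-≤ a (≤-trans b≤a (m≤m+n a 0)))
... | inj₂ a≤b = inj₂ (+-mono-≤ a≤b (m≤m+n b 0))

count-half : (A B : Ind n) → ∃ λ b → count A ≤ 2 * count (A ∩ᵇ (λ y → B y xor b))
count-half A B with ≤-twice-larger (count (A ∩ᵇ B)) (count (A ∩ᵇ ∁ᵇ B))
... | inj₁ le = false , subst₂ _≤_ (sym (count-split A B))
                          (cong (2 *_) (count-cong λ y → cong (A y ∧_) (sym (xor-identityʳ (B y))))) le
... | inj₂ le = true , subst₂ _≤_ (sym (count-split A B))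
                          (cong (2 *_) (count-cong λ y → cong (A y ∧_) (sym (xor-comm (B y) true)))) le

parity-cong : {A B : Ind n} → A ≗ B → parity A ≡ parity B
parity-cong {zero}  eq = refl
parity-cong {suc n} eq = cong₂ _xor_ (eq zero) (parity-cong (eq ∘ suc))

parity-empty : (A : Ind n) → (∀ y → A y ≡ false) → parity A ≡ false
parity-empty {zero}  A none = refl
parity-empty {suc n} A none rewrite none zero = parity-empty (A ∘ suc) (none ∘ suc)

parity-⊕ : (A B : Ind n) → parity (A ⊕ᵇ B) ≡ parity A xor parity B
parity-⊕ {zero}  A B = refl
parity-⊕ {suc n} A B = trans (cong ((A zero xor B zero) xor_) (parity-⊕ (A ∘ suc) (B ∘ suc)))
                             (xor-interchange (A zero) (B zero) (parity (A ∘ suc)) (parity (B ∘ suc)))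

parity-· : (b : Bool) (A : Ind n) → parity (b ·ᵇ A) ≡ b ∧ parity A
parity-· true  A = refl
parity-· false A = parity-empty (false ·ᵇ A) (λ _ → refl)

parity-⁅⁆ : (A : Ind n) (v : Fin n) → parity (A ∩ᵇ ⁅ v ⁆ᵇ) ≡ A v
parity-⁅⁆ {suc n} A zero
  rewrite ∧-identityʳ (A zero) | parity-empty ((A ∘ suc) ∩ᵇ ∅ᵇ) (∧-zeroʳ ∘ A ∘ suc) = xor-identityʳ (A zero)
parity-⁅⁆ {suc n} A (suc v) rewrite ∧-zeroʳ (A zero) = parity-⁅⁆ (A ∘ suc) v

-- Parity of the number of neighbours in a set

oddDeg : (Fin m → Ind n) → Ind n → Ind m
oddDeg R S x = parity (S ∩ᵇ R x)

module _ (R : Fin m → Ind n) where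

  oddDeg-cong : {S S′ : Ind n} → S ≗ S′ → oddDeg R S ≗ oddDeg R S′
  oddDeg-cong eq x = parity-cong (λ y → cong (_∧ R x y) (eq y))

  oddDeg-⊕ : (S S′ : Ind n) (x : Fin m) → oddDeg R (S ⊕ᵇ S′) x ≡ oddDeg R S x xor oddDeg R S′ x
  oddDeg-⊕ S S′ x = trans (parity-cong (λ y → ∧-distribʳ-xor (R x y) (S y) (S′ y))) (parity-⊕ (S ∩ᵇ R x) (S′ ∩ᵇ R x))

  oddDeg-· : (b : Bool) (S : Ind n) (x : Fin m) → oddDeg R (b ·ᵇ S) x ≡ b ∧ oddDeg R S x
  oddDeg-· b S x = trans (parity-cong (λ y → ∧-assoc b (S y) (R x y))) (parity-· b (S ∩ᵇ R x))

  oddDeg-⁅⁆ : (v : Fin n) (x : Fin m) → oddDeg R ⁅ v ⁆ᵇ x ≡ R x v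
  oddDeg-⁅⁆ v x = trans (parity-cong (λ y → ∧-comm (⁅ v ⁆ᵇ y) (R x y))) (parity-⁅⁆ (R x) v)

  oddDeg-none : (S : Ind n) (x : Fin m) → (∀ y → S y ≡ true → R x y ≡ false) → oddDeg R S x ≡ false
  oddDeg-none S x none = parity-empty _ no-term
    where
    no-term : ∀ y → S y ∧ R x y ≡ false
    no-term y with S y in e
    ... | true  = none y e
    ... | false = refl

  oddDeg-unique : (S : Ind n) (x : Fin m) (u : Fin n) →
    (∀ y → S y ≡ true → R x y ≡ true → y ≡ u) → oddDeg R S x ≡ S u ∧ R x u
  oddDeg-unique S x u only-u = trans (parity-cong term) (parity-⁅⁆ (λ _ → S u ∧ R x u) u)
    where
    term : ∀ y → S y ∧ R x y ≡ (S u ∧ R x u) ∧ ⁅ u ⁆ᵇ y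
    term y with y ≟ u
    ... | yes refl = sym (∧-identityʳ _)
    ... | no  y≢u with S y in sy | R x y in rxy
    ...   | true  | true  = contradiction (only-u y sy rxy) y≢u
    ...   | true  | false = sym (∧-zeroʳ _)
    ...   | false | _     = sym (∧-zeroʳ _)

  nbr-off : (u : Fin n) {us : List (Fin n)} (X : Ind m) →
    (∀ x → X x ≡ true → ∃ λ u′ → u′ ∈ₗ u ∷ us × R x u′ ≡ true) →
    ∀ x → (X ∩ᵇ ∁ᵇ (flip R u)) x ≡ true → ∃ λ u′ → u′ ∈ₗ us × R x u′ ≡ true
  nbr-off u X nbr x Xx with nbr x (∧-trueˡ Xx)
  ... | u′ , there u′∈us , Rxu′ = u′ , u′∈us , Rxu′
  ... | .u , here refl , Rxu with () ← trans (sym Rxu) (not-true (∧-trueʳ Xx))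

  toggle-bound : (u : Fin n) (X : Ind m) (T : Ind n) (b : Bool) →
    count (X ∩ᵇ flip R u) ≤ 2 * count ((X ∩ᵇ flip R u) ∩ᵇ (λ x → oddDeg R T x xor b)) →
    count (X ∩ᵇ ∁ᵇ (flip R u)) ≤ 2 * count ((X ∩ᵇ ∁ᵇ (flip R u)) ∩ᵇ oddDeg R T) →
    count X ≤ 2 * count (X ∩ᵇ oddDeg R (T ⊕ᵇ b ·ᵇ ⁅ u ⁆ᵇ))
  toggle-bound u X T b bound-on-u bound-off-u = begin
    count X                                    ≡⟨ count-split X (flip R u) ⟩
    count on-u + count off-u                   ≤⟨ +-mono-≤ bound-on-u bound-off-u ⟩
    2 * count good-on-u + 2 * count good-off-u ≡⟨ *-distribˡ-+ 2 (count good-on-u) (count good-off-u) ⟨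
    2 * (count good-on-u + count good-off-u)   ≡⟨ cong (2 *_) (trans (count-split (X ∩ᵇ oddDeg R T′) (flip R u))
                                                    (cong₂ _+_ (count-cong split-on-u) (count-cong split-off-u))) ⟨
    2 * count (X ∩ᵇ oddDeg R T′)               ∎
    where
    open ≤-Reasoning
    on-u off-u good-on-u good-off-u : Ind m
    on-u       = X ∩ᵇ flip R u
    off-u      = X ∩ᵇ ∁ᵇ (flip R u)
    good-on-u  = on-u ∩ᵇ (λ x → oddDeg R T x xor b)
    good-off-u = off-u ∩ᵇ oddDeg R T
    T′ : Ind n
    T′ = T ⊕ᵇ b ·ᵇ ⁅ u ⁆ᵇ
    oddDeg-T′ : ∀ x → oddDeg R T′ x ≡ oddDeg R T x xor (b ∧ R x u)
    oddDeg-T′ x = trans (oddDeg-⊕ T (b ·ᵇ ⁅ u ⁆ᵇ) x) (cong (oddDeg R T x xor_)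
                   (trans (oddDeg-· b ⁅ u ⁆ᵇ x) (cong (b ∧_) (oddDeg-⁅⁆ u x))))
    guarded : ∀ a c d r → (r ≡ true → c ≡ d) → (a ∧ c) ∧ r ≡ (a ∧ r) ∧ d
    guarded a c d true  c≡d = trans (∧-identityʳ _) (trans (cong (a ∧_) (c≡d refl)) (cong (_∧ d) (sym (∧-identityʳ a))))
    guarded a c d false _   = trans (∧-zeroʳ _) (sym (cong (_∧ d) (∧-zeroʳ a)))
    split-on-u : (X ∩ᵇ oddDeg R T′) ∩ᵇ flip R u ≗ good-on-u
    split-on-u x = guarded (X x) _ _ (R x u) λ Rxu →
      trans (oddDeg-T′ x) (cong (oddDeg R T x xor_) (trans (cong (b ∧_) Rxu) (∧-identityʳ b)))
    split-off-u : (X ∩ᵇ oddDeg R T′) ∩ᵇ ∁ᵇ (flip R u) ≗ good-off-u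
    split-off-u x = guarded (X x) _ _ (not (R x u)) λ ¬Rxu →
      trans (oddDeg-T′ x) (trans (cong (λ r → oddDeg R T x xor (b ∧ r)) (not-true ¬Rxu))
                                (trans (cong (oddDeg R T x xor_) (∧-zeroʳ b)) (xor-identityʳ _)))

  parity-majority : (us : List (Fin n)) (X : Ind m) →
    (∀ x → X x ≡ true → ∃ λ u → u ∈ₗ us × R x u ≡ true) →
    ∃ λ T → (∀ y → T y ≡ true → y ∈ₗ us) × count X ≤ 2 * count (X ∩ᵇ oddDeg R T)
  parity-majority [] X nbr = ∅ᵇ , (λ _ ()) , ≤-trans (≤-reflexive (count-empty X no-x)) z≤n
    where
    no-x : ∀ x → X x ≡ false
    no-x x with X x in Xx
    ... | false = refl
    ... | true with nbr x Xx
    ...   | _ , () , _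
  parity-majority (u ∷ us) X nbr with parity-majority us (X ∩ᵇ ∁ᵇ (flip R u)) (nbr-off u X nbr)
  ... | T , T⊆us , bound-off-u with count-half (X ∩ᵇ flip R u) (oddDeg R T)
  ... | b , bound-on-u = T ⊕ᵇ b ·ᵇ ⁅ u ⁆ᵇ , T′⊆ , toggle-bound u X T b bound-on-u bound-off-u
    where
    T′⊆ : ∀ y → (T ⊕ᵇ b ·ᵇ ⁅ u ⁆ᵇ) y ≡ true → y ∈ₗ u ∷ us
    T′⊆ y T′y with T y in Ty
    ... | true  = there (T⊆us y Ty)
    ... | false = here (⁅⁆ᵇ-true (∧-trueʳ T′y))

-- Gallai's even partition theorem

Even Odd : Graph n → Ind n → Set
Even G S = ∀ x → S x ≡ true → oddDeg (adj G) S x ≡ false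
Odd  G S = ∀ x → S x ≡ true → oddDeg (adj G) S x ≡ true

localComplement : Graph n → Fin n → Graph n
adj (localComplement G v) x = adj G x ⊕ᵇ adj G v x ·ᵇ (adj G v ∩ᵇ ∁ᵇ ⁅ x ⁆ᵇ)
Graph.sym (localComplement G v) x y =
  cong₂ _xor_ (Graph.sym G x y)
    (trans (cong (λ e → adj G v x ∧ (adj G v y ∧ not e)) (⁅⁆ᵇ-sym x y))
           (∧-x∙yz≈y∙xz (adj G v x) (adj G v y) (not (⁅ y ⁆ᵇ x))))
irrfl (localComplement G v) x
  rewrite irrfl G x | ⁅⁆ᵇ-refl x | ∧-zeroʳ (adj G v x) = ∧-zeroʳ (adj G v x)

module _ (G : Graph n) (v : Fin n) where

  oddDeg-localComplement : (S : Ind n) (x : Fin n) → S x ≡ true →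
    oddDeg (adj (localComplement G v)) S x ≡ oddDeg (adj G) S x xor (adj G v x ∧ (oddDeg (adj G) S v xor adj G v x))
  oddDeg-localComplement S x Sx = begin
    oddDeg (adj (localComplement G v)) S x
      ≡⟨ parity-cong (λ y → trans (∧-distribˡ-xor (S y) _ _) (cong (S y ∧ adj G x y xor_) (∧-x∙yz≈y∙xz (S y) c _))) ⟩
    parity (S ∩ᵇ adj G x ⊕ᵇ c ·ᵇ (S ∩ᵇ adj G v ∩ᵇ ∁ᵇ ⁅ x ⁆ᵇ))
      ≡⟨ parity-⊕ (S ∩ᵇ adj G x) (c ·ᵇ (S ∩ᵇ adj G v ∩ᵇ ∁ᵇ ⁅ x ⁆ᵇ)) ⟩
    oddDeg (adj G) S x xor parity (c ·ᵇ (S ∩ᵇ adj G v ∩ᵇ ∁ᵇ ⁅ x ⁆ᵇ))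
      ≡⟨ cong (oddDeg (adj G) S x xor_) (parity-· c (S ∩ᵇ adj G v ∩ᵇ ∁ᵇ ⁅ x ⁆ᵇ)) ⟩
    oddDeg (adj G) S x xor (c ∧ parity (S ∩ᵇ adj G v ∩ᵇ ∁ᵇ ⁅ x ⁆ᵇ))
      ≡⟨ cong (λ p → oddDeg (adj G) S x xor (c ∧ p)) without-x ⟩
    oddDeg (adj G) S x xor (c ∧ (oddDeg (adj G) S v xor c))
      ∎
    where
    open ≡-Reasoning
    c : Bool
    c = adj G v x
    ∧-not : ∀ a e → a ∧ not e ≡ a xor (a ∧ e)
    ∧-not true  e = refl
    ∧-not false e = refl
    without-x : parity (S ∩ᵇ adj G v ∩ᵇ ∁ᵇ ⁅ x ⁆ᵇ) ≡ oddDeg (adj G) S v xor c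
    without-x = begin
      parity (S ∩ᵇ adj G v ∩ᵇ ∁ᵇ ⁅ x ⁆ᵇ)
        ≡⟨ parity-cong (λ y → trans (sym (∧-assoc (S y) _ _)) (∧-not (S y ∧ adj G v y) (⁅ x ⁆ᵇ y))) ⟩
      parity (S ∩ᵇ adj G v ⊕ᵇ (S ∩ᵇ adj G v) ∩ᵇ ⁅ x ⁆ᵇ)
        ≡⟨ parity-⊕ (S ∩ᵇ adj G v) ((S ∩ᵇ adj G v) ∩ᵇ ⁅ x ⁆ᵇ) ⟩
      oddDeg (adj G) S v xor parity ((S ∩ᵇ adj G v) ∩ᵇ ⁅ x ⁆ᵇ)
        ≡⟨ cong (oddDeg (adj G) S v xor_) (parity-⁅⁆ (S ∩ᵇ adj G v) x) ⟩
      oddDeg (adj G) S v xor (S x ∧ c)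
        ≡⟨ cong (λ s → oddDeg (adj G) S v xor (s ∧ c)) Sx ⟩
      oddDeg (adj G) S v xor c
        ∎

  lift-even : (S : Ind n) → Even (localComplement G v) S → oddDeg (adj G) S v ≡ true → Even G S
  lift-even S even odd x Sx = begin
    o                                 ≡⟨ xor-identityʳ o ⟨
    o xor false                       ≡⟨ cong (o xor_) (∧-inverseʳ c) ⟨
    o xor (c ∧ (true xor c))          ≡⟨ cong (λ p → o xor (c ∧ (p xor c))) odd ⟨
    o xor (c ∧ (oddDeg (adj G) S v xor c)) ≡⟨ oddDeg-localComplement S x Sx ⟨
    oddDeg (adj (localComplement G v)) S x      ≡⟨ even x Sx ⟩
    false                             ∎
    where
    open ≡-Reasoning
    o c : Bool
    o = oddDeg (adj G) S x
    c = adj G v x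

  lift-even-with-v : (S : Ind n) → Even (localComplement G v) S → oddDeg (adj G) S v ≡ false → Even G (S ⊕ᵇ ⁅ v ⁆ᵇ)
  lift-even-with-v S even even-v x Sx′ =
    trans (oddDeg-⊕ (adj G) S ⁅ v ⁆ᵇ x) (trans (cong (oddDeg (adj G) S x xor_) (oddDeg-⁅⁆ (adj G) v x)) (at x Sx′))
    where
    open ≡-Reasoning
    at : ∀ x → (S ⊕ᵇ ⁅ v ⁆ᵇ) x ≡ true → oddDeg (adj G) S x xor adj G x v ≡ false
    at x Sx′ with x ≟ v
    ... | yes refl = cong₂ _xor_ even-v (irrfl G v)
    ... | no  x≢v  = begin
      o xor adj G x v                        ≡⟨ cong (o xor_) (trans (∧-idem c) (Graph.sym G v x)) ⟨
      o xor (c ∧ c)                          ≡⟨ cong (λ p → o xor (c ∧ (p xor c))) even-v ⟨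
      o xor (c ∧ (oddDeg (adj G) S v xor c)) ≡⟨ oddDeg-localComplement S x Sx ⟨
      oddDeg (adj (localComplement G v)) S x           ≡⟨ even x Sx ⟩
      false                                  ∎
      where
      o c : Bool
      o = oddDeg (adj G) S x
      c = adj G v x
      Sx : S x ≡ true
      Sx = trans (sym (xor-identityʳ (S x))) Sx′

disjoint-sym : {A B : Ind n} → Disjointᵇ A B → Disjointᵇ B A
disjoint-sym {A = A} disj y By with A y in Ay
... | false = refl
... | true with () ← trans (sym By) (disj y Ay)

record EvenSplit (G : Graph n) (D : Ind n) : Set where
  field
    left right : Ind n
    splits     : D ≗ left ⊕ᵇ right
    disjoint   : Disjointᵇ left right
    left-even  : Even G left
    right-even : Even G right

  left⊆ : left ⊆ᵇ D
  left⊆ y Ly = trans (splits y) (cong₂ _xor_ Ly (disjoint y Ly))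

  right⊆ : right ⊆ᵇ D
  right⊆ y Ry = trans (splits y) (cong₂ _xor_ (disjoint-sym disjoint y Ry) Ry)

  count-parts : count D ≡ count left + count right
  count-parts = trans (count-cong splits) (count-⊕ left right disjoint)

  larger-part : ∃ λ A → A ⊆ᵇ D × Even G A × count D ≤ 2 * count A
  larger-part with ≤-twice-larger (count left) (count right)
  ... | inj₁ le = left  , left⊆  , left-even  , ≤-trans (≤-reflexive count-parts) le
  ... | inj₂ le = right , right⊆ , right-even , ≤-trans (≤-reflexive count-parts) le

open EvenSplit

swap : {G : Graph n} {D : Ind n} → EvenSplit G D → EvenSplit G D
swap s = record
  { left       = right s
  ; right      = left s
  ; splits     = λ y → trans (splits s y) (xor-comm (left s y) (right s y))
  ; disjoint   = disjoint-sym (disjoint s)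
  ; left-even  = right-even s
  ; right-even = left-even s
  }

all-left : (G : Graph n) (D : Ind n) → Even G D → EvenSplit G D
all-left G D even = record
  { left       = D
  ; right      = ∅ᵇ
  ; splits     = λ y → sym (xor-identityʳ (D y))
  ; disjoint   = λ _ _ → refl
  ; left-even  = even
  ; right-even = λ _ ()
  }

module _ (G : Graph n) (D : Ind n) (v : Fin n) (Dv : D v ≡ true) where

  private
    D′ : Ind n
    D′ = D ⊕ᵇ ⁅ v ⁆ᵇ

    v∉D′ : D′ v ≡ false
    v∉D′ = cong₂ _xor_ Dv (⁅⁆ᵇ-refl v)

  put-v-left : (s : EvenSplit (localComplement G v) D′) →
    oddDeg (adj G) (left s) v ≡ false → oddDeg (adj G) (right s) v ≡ true → EvenSplit G D
  put-v-left s even-left odd-right = record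
    { left       = left s ⊕ᵇ ⁅ v ⁆ᵇ
    ; right      = right s
    ; splits     = λ y → begin
        D y                                      ≡⟨ xor-cancelʳ (D y) (⁅ v ⁆ᵇ y) ⟨
        D′ y xor ⁅ v ⁆ᵇ y                        ≡⟨ cong (_xor ⁅ v ⁆ᵇ y) (splits s y) ⟩
        (left s y xor right s y) xor ⁅ v ⁆ᵇ y    ≡⟨ xor-xy∙z≈xz∙y (left s y) (right s y) (⁅ v ⁆ᵇ y) ⟩
        (left s y xor ⁅ v ⁆ᵇ y) xor right s y    ∎
    ; disjoint   = disjoint-sym λ y Ry →
        cong₂ _xor_ (disjoint-sym (disjoint s) y Ry) (⁅⁆ᵇ-false (right≢v y Ry))
    ; left-even  = lift-even-with-v G v (left s) (left-even s) even-left
    ; right-even = lift-even G v (right s) (right-even s) odd-right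
    }
    where
    open ≡-Reasoning
    right≢v : ∀ y → right s y ≡ true → y ≢ v
    right≢v y Ry refl with () ← trans (sym (right⊆ s v Ry)) v∉D′
    xor-cancelʳ : ∀ a e → (a xor e) xor e ≡ a
    xor-cancelʳ a e = trans (xor-assoc a e e) (trans (cong (a xor_) (xor-same e)) (xor-identityʳ a))

  parts-odd : oddDeg (adj G) D v ≡ true → (s : EvenSplit (localComplement G v) D′) →
    oddDeg (adj G) (left s) v xor oddDeg (adj G) (right s) v ≡ true
  parts-odd odd s = begin
      oddDeg (adj G) (left s) v xor oddDeg (adj G) (right s) v ≡⟨ oddDeg-⊕ (adj G) (left s) (right s) v ⟨
      oddDeg (adj G) (left s ⊕ᵇ right s) v                    ≡⟨ oddDeg-cong (adj G) (splits s) v ⟨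
      oddDeg (adj G) D′ v                                     ≡⟨ oddDeg-⊕ (adj G) D ⁅ v ⁆ᵇ v ⟩
      oddDeg (adj G) D v xor oddDeg (adj G) ⁅ v ⁆ᵇ v         ≡⟨ cong₂ _xor_ odd (trans (oddDeg-⁅⁆ (adj G) v v) (irrfl G v)) ⟩
      true                                                    ∎
    where open ≡-Reasoning

  insert-odd-vertex : oddDeg (adj G) D v ≡ true → EvenSplit (localComplement G v) D′ → EvenSplit G D
  insert-odd-vertex odd s with oddDeg (adj G) (left s) v in eL | parts-odd odd s
  ... | false | odd-right = put-v-left s eL odd-right
  ... | true  | odd-right = put-v-left (swap s) (not-true odd-right) eL

odd-vertex? : (G : Graph n) (D : Ind n) → (∃ λ v → D v ≡ true × oddDeg (adj G) D v ≡ true) ⊎ Even G D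
odd-vertex? G D with any? (λ v → (D ∩ᵇ oddDeg (adj G) D) v ≟𝔹 true)
... | yes (v , odd-v) = inj₁ (v , ∧-trueˡ odd-v , ∧-trueʳ odd-v)
... | no  none        = inj₂ λ x Dx → ¬-not λ odd-x → none (x , cong₂ _∧_ Dx odd-x)

gallai : (G : Graph n) (D : Ind n) → EvenSplit G D
gallai G D = split G D (<-wellFounded (count D))
  where
  split : (G : Graph n) (D : Ind n) → Acc _<_ (count D) → EvenSplit G D
  split G D (acc smaller) with odd-vertex? G D
  ... | inj₂ even             = all-left G D even
  ... | inj₁ (v , Dv , odd-v) = insert-odd-vertex G D v Dv odd-v
          (split (localComplement G v) (D ⊕ᵇ ⁅ v ⁆ᵇ) (smaller (≤-reflexive (sym (count-remove D v Dv)))))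

∣∣≡count : (V : Subset n) → ∣ V ∣ ≡ count (lookup V)
∣∣≡count []          = refl
∣∣≡count (true  ∷ V) = cong suc (∣∣≡count V)
∣∣≡count (false ∷ V) = ∣∣≡count V

lookup-∖ : (V V′ : Subset n) (y : Fin n) → lookup (V ∖ V′) y ≡ lookup V y ∧ not (lookup V′ y)
lookup-∖ (_ ∷ _) (_ ∷ _)  zero    = refl
lookup-∖ (_ ∷ V) (_ ∷ V′) (suc y) = lookup-∖ V V′ y

module _ (G : Graph n) (S : Subset n) (v : Fin n) where

  private
    hit : Fin n → Bool
    hit s = lookup S s ∧ adj G s v

    any-hit : ∀ xs → foldr (λ s b → hit s ∨ b) false xs ≡ true → ∃ λ s → hit s ≡ true
    any-hit (s ∷ xs) found with hit s in e
    ... | true  = s , e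
    ... | false = any-hit xs found

    hit-any : ∀ {s} xs → s ∈ₗ xs → hit s ≡ true → foldr (λ s b → hit s ∨ b) false xs ≡ true
    hit-any (_ ∷ _)  (here refl) hs = cong (_∨ _) hs
    hit-any (s ∷ xs) (there s∈) hs  = trans (cong (hit s ∨_) (hit-any xs s∈ hs)) (∨-zeroʳ (hit s))

  N-elim : lookup (N G S) v ≡ true → ∃ λ s → lookup S s ≡ true × adj G s v ≡ true
  N-elim v∈N with any-hit (allFin n) (trans (sym (lookup∘tabulate _ v)) v∈N)
  ... | s , hs = s , ∧-trueˡ hs , ∧-trueʳ hs

  N-intro : (s : Fin n) → lookup S s ≡ true → adj G s v ≡ true → lookup (N G S) v ≡ true
  N-intro s Ss adj-sv = trans (lookup∘tabulate _ v) (hit-any (allFin n) (∈-allFin s) (cong₂ _∧_ Ss adj-sv))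

degIn-%2 : (G : Graph n) (V : Subset n) (v : Fin n) → (degIn G V v % 2 ≡ᵇ 1) ≡ oddDeg (adj G) (lookup V) v
degIn-%2 G V v = begin
  (∣ V ∩ Nv G v ∣ % 2 ≡ᵇ 1)              ≡⟨ cong (λ c → c % 2 ≡ᵇ 1) (∣∣≡count (V ∩ Nv G v)) ⟩
  (count (lookup (V ∩ Nv G v)) % 2 ≡ᵇ 1) ≡⟨ count-%2 (lookup (V ∩ Nv G v)) ⟩
  parity (lookup (V ∩ Nv G v))           ≡⟨ parity-cong lookup-∩ ⟩
  oddDeg (adj G) (lookup V) v            ∎
  where
  open ≡-Reasoning
  lookup-∩ : lookup (V ∩ Nv G v) ≗ lookup V ∩ᵇ adj G v
  lookup-∩ y = trans (lookup-zipWith _∧_ y V (Nv G v)) (cong (lookup V y ∧_) (lookup∘tabulate _ y))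

allOddB-intro : (G : Graph n) (V : Subset n) → Odd G (lookup V) → allOddB G V ≡ true
allOddB-intro {n} G V odd = all-true (allFin n)
  where
  vertex-ok : ∀ v → (not (lookup V v) ∨ (degIn G V v % 2 ≡ᵇ 1)) ≡ true
  vertex-ok v with lookup V v in Vv
  ... | false = refl
  ... | true  = trans (degIn-%2 G V v) (odd v Vv)
  all-true : ∀ vs → foldr (λ v b → (not (lookup V v) ∨ (degIn G V v % 2 ≡ᵇ 1)) ∧ b) true vs ≡ true
  all-true []       = refl
  all-true (v ∷ vs) = cong₂ _∧_ (vertex-ok v) (all-true vs)

∈-allSubsets : (V : Subset n) → V ∈ₗ allSubsets n
∈-allSubsets []                   = here refl
∈-allSubsets {suc n} (true  ∷ V) = ∈-++⁺ˡ (∈-map⁺ (true ∷_) (∈-allSubsets V))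
∈-allSubsets {suc n} (false ∷ V) = ∈-++⁺ʳ (map (true ∷_) (allSubsets n)) (∈-map⁺ (false ∷_) (∈-allSubsets V))

≤-fo : (G : Graph n) (V : Subset n) → allOddB G V ≡ true → ∣ V ∣ ≤ fo G
≤-fo {n} G V all-odd =
  subst (_≤ fo G) (cong (if_then ∣ V ∣ else 0) all-odd) (≤-foldr-⊔ (allSubsets n) (∈-allSubsets V))
  where
  size : Subset n → ℕ
  size V₀ = if allOddB G V₀ then ∣ V₀ ∣ else 0
  ≤-foldr-⊔ : ∀ {V₀} Vs → V₀ ∈ₗ Vs → size V₀ ≤ foldr (λ V₁ m → size V₁ ⊔ m) 0 Vs
  ≤-foldr-⊔ (V₁ ∷ Vs) (here refl) = m≤m⊔n (size V₁) _
  ≤-foldr-⊔ (V₁ ∷ Vs) (there V₀∈) = ≤-trans (≤-foldr-⊔ Vs V₀∈) (m≤n⊔m (size V₁) _)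

odd-≤-fo : (G : Graph n) (S : Ind n) → Odd G S → count S ≤ fo G
odd-≤-fo {n} G S odd = subst (_≤ fo G) size-V (≤-fo G V (allOddB-intro G V odd-V))
  where
  V : Subset n
  V = tabulate S
  size-V : ∣ V ∣ ≡ count S
  size-V = trans (∣∣≡count V) (count-cong (lookup∘tabulate S))
  odd-V : Odd G (lookup V)
  odd-V v Vv = trans (oddDeg-cong (adj G) (lookup∘tabulate S) v) (odd v (trans (sym (lookup∘tabulate S v)) Vv))

-- Matchings whose W-vertices are pendant

Endpoint : Fin n → Fin n × Fin n → Set
Endpoint x e = x ≡ proj₁ e ⊎ x ≡ proj₂ e

∈-endpoints : ∀ {M : List (Fin n × Fin n)} {x e} → e ∈ₗ M → Endpoint x e → x ∈ₗ endpoints M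
∈-endpoints (here refl) (inj₁ refl) = here refl
∈-endpoints (here refl) (inj₂ refl) = there (here refl)
∈-endpoints {M = _ ∷ _} (there e∈M) x∈e = there (there (∈-endpoints e∈M x∈e))

first-endpoint-fresh : ∀ {x e} {M : List (Fin n × Fin n)} →
  Unique (endpoints (e ∷ M)) → Endpoint x e → x ∈ₗ endpoints M → ⊥
first-endpoint-fresh ((_ ∷ fresh₁) ∷ _) (inj₁ refl) x∈M = All-lookup fresh₁ x∈M refl
first-endpoint-fresh (_ ∷ fresh₂ ∷ _)   (inj₂ refl) x∈M = All-lookup fresh₂ x∈M refl

shared-endpoint : {M : List (Fin n × Fin n)} → Unique (endpoints M) →
  ∀ {x e e′} → e ∈ₗ M → e′ ∈ₗ M → Endpoint x e → Endpoint x e′ → e ≡ e′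
shared-endpoint _ (here refl) (here refl) _ _ = refl
shared-endpoint {M = _ ∷ M} u (here refl) (there e′∈M) x∈e x∈e′ =
  ⊥-elim (first-endpoint-fresh {M = M} u x∈e (∈-endpoints e′∈M x∈e′))
shared-endpoint {M = _ ∷ M} u (there e∈M) (here refl) x∈e x∈e′ =
  ⊥-elim (first-endpoint-fresh {M = M} u x∈e′ (∈-endpoints e∈M x∈e))
shared-endpoint (_ ∷ _ ∷ u) (there e∈M) (there e′∈M) x∈e x∈e′ = shared-endpoint u e∈M e′∈M x∈e x∈e′

count-≡1 : (A : Ind n) → count A ≡ 1 → ∀ {y z} → A y ≡ true → A z ≡ true → z ≡ y
count-≡1 A one {y} {z} Ay Az with z ≟ y
... | yes z≡y = z≡y
... | no  z≢y = contradiction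
    (trans (sym (suc-injective (trans (sym (count-remove A y Ay)) one)))
           (count-remove (A ⊕ᵇ ⁅ y ⁆ᵇ) z (trans (cong (A z xor_) (⁅⁆ᵇ-false z≢y)) (trans (xor-identityʳ (A z)) Az))))
    0≢1+n

record PendantMatching (G : Graph n) (U W : Ind n) : Set where
  field
    mateᵤ : ∀ u → U u ≡ true →
      ∃ λ w → W w ≡ true × adj G u w ≡ true × (∀ w′ → W w′ ≡ true → adj G u w′ ≡ true → w′ ≡ w)
    mateʷ : ∀ w → W w ≡ true →
      ∃ λ u → U u ≡ true × adj G w u ≡ true × (∀ u′ → U u′ ≡ true → adj G w u′ ≡ true → u′ ≡ u)
    W-independent : ∀ w w′ → W w ≡ true → W w′ ≡ true → adj G w w′ ≡ false

module _ (G : Graph n) (M : List (Fin n × Fin n)) (U W : Subset n) (matching : IsMatching G M)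
  (U-ends : ∀ x → (x ∈ U) ⇔ (∃ λ e → e ∈ₗ M × proj₁ e ≡ x))
  (W-ends : ∀ x → (x ∈ W) ⇔ (∃ λ e → e ∈ₗ M × proj₂ e ≡ x))
  (W-degree : ∀ w → w ∈ W → ∣ Nv G w ∩ (U ∪ W) ∣ ≡ 1) where

  private
    edge-at-U : ∀ {u} → lookup U u ≡ true → ∃ λ e → e ∈ₗ M × proj₁ e ≡ u
    edge-at-U {u} Uu = Equivalence.to (U-ends u) (lookup⇒[]= u U Uu)

    edge-at-W : ∀ {w} → lookup W w ≡ true → ∃ λ e → e ∈ₗ M × proj₂ e ≡ w
    edge-at-W {w} Ww = Equivalence.to (W-ends w) (lookup⇒[]= w W Ww)

    U-end : ∀ {e} → e ∈ₗ M → lookup U (proj₁ e) ≡ true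
    U-end e∈M = []=⇒lookup (Equivalence.from (U-ends _) (_ , e∈M , refl))

    W-end : ∀ {e} → e ∈ₗ M → lookup W (proj₂ e) ≡ true
    W-end e∈M = []=⇒lookup (Equivalence.from (W-ends _) (_ , e∈M , refl))

    edge : ∀ {e} → e ∈ₗ M → adj G (proj₁ e) (proj₂ e) ≡ true
    edge e∈M = Equivalence.to T-≡ (All-lookup (IsMatching.edges matching) e∈M)

    edge′ : ∀ {e} → e ∈ₗ M → adj G (proj₂ e) (proj₁ e) ≡ true
    edge′ e∈M = trans (Graph.sym G _ _) (edge e∈M)

    same-edge : ∀ {x e e′} → e ∈ₗ M → e′ ∈ₗ M → Endpoint x e → Endpoint x e′ → e ≡ e′
    same-edge = shared-endpoint (IsMatching.disjoint matching)

    U∩W : Disjointᵇ (lookup U) (lookup W)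
    U∩W x Ux with lookup W x in Wx
    ... | false = refl
    ... | true with edge-at-U Ux | edge-at-W Wx
    ...   | e , e∈M , refl | e′ , e′∈M , e′→x with same-edge e∈M e′∈M (inj₁ refl) (inj₂ (sym e′→x))
    ...     | refl with () ← trans (sym (irrfl G _)) (trans (cong (adj G _) (sym e′→x)) (edge e∈M))

    U∪W : Ind n
    U∪W z = lookup U z ∨ lookup W z

    W-nbr-unique : ∀ {w z z′} → lookup W w ≡ true →
      adj G w z ≡ true → U∪W z ≡ true → adj G w z′ ≡ true → U∪W z′ ≡ true → z′ ≡ z
    W-nbr-unique {w} Ww wz z∈ wz′ z′∈ = count-≡1 (adj G w ∩ᵇ U∪W) one (cong₂ _∧_ wz z∈) (cong₂ _∧_ wz′ z′∈)
      where
      one : count (adj G w ∩ᵇ U∪W) ≡ 1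
      one = trans (count-cong λ z → sym (trans (lookup-zipWith _∧_ z (Nv G w) (U ∪ W))
                    (cong₂ _∧_ (lookup∘tabulate _ z) (lookup-zipWith _∨_ z U W))))
                  (trans (sym (∣∣≡count (Nv G w ∩ (U ∪ W)))) (W-degree w (lookup⇒[]= w W Ww)))

    in-U : ∀ {z} → lookup U z ≡ true → U∪W z ≡ true
    in-U Uz = cong (_∨ _) Uz

    mateʷ : ∀ w → lookup W w ≡ true → ∃ λ u → lookup U u ≡ true × adj G w u ≡ true ×
      (∀ u′ → lookup U u′ ≡ true → adj G w u′ ≡ true → u′ ≡ u)
    mateʷ w Ww with edge-at-W Ww
    ... | e , e∈M , refl = proj₁ e , U-end e∈M , edge′ e∈M ,
            λ u′ Uu′ wu′ → W-nbr-unique Ww (edge′ e∈M) (in-U (U-end e∈M)) wu′ (in-U Uu′)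

    W-independent : ∀ w w′ → lookup W w ≡ true → lookup W w′ ≡ true → adj G w w′ ≡ false
    W-independent w w′ Ww Ww′ with adj G w w′ in ww′
    ... | false = refl
    ... | true with mateʷ w Ww
    ...   | u , Uu , wu , _ with refl ← W-nbr-unique Ww wu (in-U Uu) ww′ (trans (cong (_ ∨_) Ww′) (∨-zeroʳ _))
            with () ← trans (sym (U∩W u Uu)) Ww′

    mateᵤ : ∀ u → lookup U u ≡ true → ∃ λ w → lookup W w ≡ true × adj G u w ≡ true ×
      (∀ w′ → lookup W w′ ≡ true → adj G u w′ ≡ true → w′ ≡ w)
    mateᵤ u Uu with edge-at-U Uu
    ... | e , e∈M , refl = proj₂ e , W-end e∈M , edge e∈M , same-mate
      where
      same-mate : ∀ w′ → lookup W w′ ≡ true → adj G (proj₁ e) w′ ≡ true → w′ ≡ proj₂ e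
      same-mate w′ Ww′ uw′ with edge-at-W Ww′
      ... | e′ , e′∈M , refl with same-edge e∈M e′∈M (inj₁ refl)
             (inj₁ (W-nbr-unique Ww′ (edge′ e′∈M) (in-U (U-end e′∈M)) (trans (Graph.sym G _ _) uw′) (in-U Uu)))
      ... | refl = refl

  pendant-matching : PendantMatching G (lookup U) (lookup W)
  pendant-matching = record { mateᵤ = mateᵤ ; mateʷ = mateʷ ; W-independent = W-independent }

module _ {G : Graph n} {U W : Ind n} (pm : PendantMatching G U W) (X : Ind n)
         (X-W-nonadjacent : ∀ x w → X x ≡ true → W w ≡ true → adj G x w ≡ false)
         (X∩W : Disjointᵇ X W) where

  open PendantMatching pm

  private
    deg : Ind n → Ind n
    deg = oddDeg (adj G)

  X∩U : Disjointᵇ X U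
  X∩U x Xx with U x in Ux
  ... | false = refl
  ... | true with mateᵤ x Ux
  ...   | w , Ww , xw , _ with () ← trans (sym xw) (X-W-nonadjacent x w Xx Ww)

  module _ (T A : Ind n) (T⊆U : T ⊆ᵇ U) (A⊆ : A ⊆ᵇ X ∩ᵇ deg T) (even-A : Even G A) where

    private
      -- A vertex of W has exactly one neighbour in U, its mate, so it lies in W′ iff its mate
      -- lies in T and has even degree in T ⊕ A.
      Tₑ W′ S : Ind n
      Tₑ = T ∩ᵇ ∁ᵇ (deg (T ⊕ᵇ A))
      W′ = W ∩ᵇ deg Tₑ
      S  = (T ⊕ᵇ A) ⊕ᵇ W′

      open ≡-Reasoning

      at-T : ∀ v → T v ≡ true → deg S v ≡ true
      at-T v Tv with mateᵤ v (T⊆U v Tv)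
      ... | w , Ww , vw , only-w = begin
        deg S v                               ≡⟨ oddDeg-⊕ (adj G) (T ⊕ᵇ A) W′ v ⟩
        deg (T ⊕ᵇ A) v xor deg W′ v           ≡⟨ cong (deg (T ⊕ᵇ A) v xor_) W′-parity ⟩
        deg (T ⊕ᵇ A) v xor not (deg (T ⊕ᵇ A) v) ≡⟨ xor-inverseʳ (deg (T ⊕ᵇ A) v) ⟩
        true                                  ∎
        where
        W′-parity : deg W′ v ≡ not (deg (T ⊕ᵇ A) v)
        W′-parity = begin
          deg W′ v            ≡⟨ oddDeg-unique (adj G) W′ v w (λ y W′y → only-w y (∧-trueˡ W′y)) ⟩
          W′ w ∧ adj G v w    ≡⟨ cong₂ (λ a b → (a ∧ deg Tₑ w) ∧ b) Ww vw ⟩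
          deg Tₑ w ∧ true     ≡⟨ ∧-identityʳ (deg Tₑ w) ⟩
          deg Tₑ w            ≡⟨ oddDeg-unique (adj G) Tₑ w v only-v ⟩
          Tₑ v ∧ adj G w v    ≡⟨ cong₂ (λ t b → (t ∧ not (deg (T ⊕ᵇ A) v)) ∧ b) Tv (trans (Graph.sym G w v) vw) ⟩
          not (deg (T ⊕ᵇ A) v) ∧ true ≡⟨ ∧-identityʳ _ ⟩
          not (deg (T ⊕ᵇ A) v) ∎
          where
          only-v : ∀ y → Tₑ y ≡ true → adj G w y ≡ true → y ≡ v
          only-v y Tₑy wy with mateʷ w Ww
          ... | u , _ , _ , only-u =
            trans (only-u y (T⊆U y (∧-trueˡ Tₑy)) wy) (sym (only-u v (T⊆U v Tv) (trans (Graph.sym G w v) vw)))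

      at-A : ∀ v → T v ≡ false → A v ≡ true → deg S v ≡ true
      at-A v Tv Av = begin
        deg S v                                   ≡⟨ oddDeg-⊕ (adj G) (T ⊕ᵇ A) W′ v ⟩
        deg (T ⊕ᵇ A) v xor deg W′ v               ≡⟨ cong (_xor deg W′ v) (oddDeg-⊕ (adj G) T A v) ⟩
        (deg T v xor deg A v) xor deg W′ v        ≡⟨ cong₂ (λ a b → (a xor b) xor deg W′ v) (∧-trueʳ {X v} (A⊆ v Av)) (even-A v Av) ⟩
        true xor deg W′ v                         ≡⟨ cong not (oddDeg-none (adj G) W′ v λ y W′y → X-W-nonadjacent v y Xv (∧-trueˡ W′y)) ⟩
        true                                      ∎
        where
        Xv : X v ≡ true
        Xv = ∧-trueˡ (A⊆ v Av)

      at-W′ : ∀ v → W′ v ≡ true → deg S v ≡ true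
      at-W′ v W′v with mateʷ v (∧-trueˡ W′v)
      ... | u , Uu , vu , only-u = begin
        deg S v                                   ≡⟨ oddDeg-⊕ (adj G) (T ⊕ᵇ A) W′ v ⟩
        deg (T ⊕ᵇ A) v xor deg W′ v               ≡⟨ cong (_xor deg W′ v) (oddDeg-⊕ (adj G) T A v) ⟩
        (deg T v xor deg A v) xor deg W′ v        ≡⟨ cong₂ (λ a b → (a xor b) xor deg W′ v) T-parity A-parity ⟩
        true xor deg W′ v                         ≡⟨ cong not W′-parity ⟩
        true                                      ∎
        where
        Tₑu : Tₑ u ≡ true
        Tₑu = ∧-trueˡ (trans (sym (oddDeg-unique (adj G) Tₑ v u λ y Tₑy → only-u y (T⊆U y (∧-trueˡ Tₑy)))) (∧-trueʳ W′v))
        T-parity : deg T v ≡ true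
        T-parity = trans (oddDeg-unique (adj G) T v u λ y Ty → only-u y (T⊆U y Ty)) (cong₂ _∧_ (∧-trueˡ Tₑu) vu)
        A-parity : deg A v ≡ false
        A-parity = oddDeg-none (adj G) A v λ y Ay →
          trans (Graph.sym G v y) (X-W-nonadjacent y v (∧-trueˡ (A⊆ y Ay)) (∧-trueˡ W′v))
        W′-parity : deg W′ v ≡ false
        W′-parity = oddDeg-none (adj G) W′ v λ y W′y → W-independent v y (∧-trueˡ W′v) (∧-trueˡ W′y)

      odd-S : Odd G S
      odd-S v Sv with T v in Tv | A v in Av
      ... | true  | _     = at-T v Tv
      ... | false | true  = at-A v Tv Av
      ... | false | false = at-W′ v Sv

      A⊆S : A ⊆ᵇ S
      A⊆S v Av = trans (cong₂ (λ t w → (t xor A v) xor (w ∧ deg Tₑ v)) T∌v (X∩W v Xv)) (cong (_xor false) Av)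
        where
        Xv : X v ≡ true
        Xv = ∧-trueˡ (A⊆ v Av)
        T∌v : T v ≡ false
        T∌v with T v in Tv
        ... | false = refl
        ... | true with () ← trans (sym (T⊆U v Tv)) (X∩U v Xv)

    odd-extension : ∃ λ S → Odd G S × A ⊆ᵇ S
    odd-extension = S , odd-S , A⊆S

elements : Subset n → List (Fin n)
elements {n} U = filter (λ u → lookup U u ≟𝔹 true) (allFin n)

∈-elements : (U : Subset n) {u : Fin n} → u ∈ₗ elements U → lookup U u ≡ true
∈-elements {n} U u∈U = proj₂ (∈-filter⁻ (λ u → lookup U u ≟𝔹 true) {xs = allFin n} u∈U)

module _ (G : Graph n) (U W : Subset n) where

  outsideNbrs : Ind n
  outsideNbrs = lookup (N G U ∖ (W ∪ N G W))

  private
    X-def : ∀ x → outsideNbrs x ≡ lookup (N G U) x ∧ not (lookup W x ∨ lookup (N G W) x)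
    X-def x = trans (lookup-∖ (N G U) (W ∪ N G W) x)
                    (cong (λ b → lookup (N G U) x ∧ not b) (lookup-zipWith _∨_ x W (N G W)))

    X-avoids : ∀ {x} → outsideNbrs x ≡ true → (lookup W x ∨ lookup (N G W) x) ≡ false
    X-avoids {x} Xx = not-true (∧-trueʳ (trans (sym (X-def x)) Xx))

  outsideNbrs-U-nbr : ∀ x → outsideNbrs x ≡ true → ∃ λ u → u ∈ₗ elements U × adj G x u ≡ true
  outsideNbrs-U-nbr x Xx with N-elim G U x (∧-trueˡ (trans (sym (X-def x)) Xx))
  ... | u , Uu , ux = u , ∈-filter⁺ (λ u → lookup U u ≟𝔹 true) (∈-allFin u) Uu , trans (Graph.sym G x u) ux

  outsideNbrs∩W : Disjointᵇ outsideNbrs (lookup W)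
  outsideNbrs∩W x Xx with lookup W x in Wx
  ... | false = refl
  ... | true with () ← trans (sym (cong (_∨ lookup (N G W) x) Wx)) (X-avoids Xx)

  outsideNbrs-W-nonadjacent : ∀ x w → outsideNbrs x ≡ true → lookup W w ≡ true → adj G x w ≡ false
  outsideNbrs-W-nonadjacent x w Xx Ww with adj G x w in xw
  ... | false = refl
  ... | true with () ← trans (sym (trans (cong (lookup W x ∨_) (N-intro G W x w Ww (trans (Graph.sym G w x) xw)))
                                         (∨-zeroʳ _)))
                             (X-avoids Xx)

lemma2p3 : ∀ {n} (G : Graph n) (M : List (Fin n × Fin n)) (U W : Subset n) (k : ℕ) →
    IsMatching G M →
    (∀ x → (x ∈ U) ⇔ (∃ λ e → e ∈ₗ M × proj₁ e ≡ x)) →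
    (∀ x → (x ∈ W) ⇔ (∃ λ e → e ∈ₗ M × proj₂ e ≡ x)) →
    (∀ w → w ∈ W → ∣ Nv G w ∩ (U ∪ W) ∣ ≡ 1) →
    k ≤ ∣ N G U ∖ (W ∪ N G W) ∣ →
    k ≤ 4 * fo G
lemma2p3 G M U W k matching U-ends W-ends W-degree k≤ =
  let X = outsideNbrs G U W
      T , T⊆U , X≤ = parity-majority (adj G) (elements U) X (outsideNbrs-U-nbr G U W)
      A , A⊆ , even-A , X′≤ = larger-part (gallai G (X ∩ᵇ oddDeg (adj G) T))
      S , odd-S , A⊆S = odd-extension (pendant-matching G M U W matching U-ends W-ends W-degree) X
                          (outsideNbrs-W-nonadjacent G U W) (outsideNbrs∩W G U W)
                          T A (λ y → ∈-elements U ∘ T⊆U y) A⊆ even-A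
  in begin
    k                                   ≤⟨ k≤ ⟩
    ∣ N G U ∖ (W ∪ N G W) ∣             ≡⟨ ∣∣≡count (N G U ∖ (W ∪ N G W)) ⟩
    count X                             ≤⟨ X≤ ⟩
    2 * count (X ∩ᵇ oddDeg (adj G) T)   ≤⟨ *-monoʳ-≤ 2 X′≤ ⟩
    2 * (2 * count A)                   ≡⟨ *-assoc 2 2 (count A) ⟨
    4 * count A                         ≤⟨ *-monoʳ-≤ 4 (≤-trans (count-mono A S A⊆S) (odd-≤-fo G S odd-S)) ⟩
    4 * fo G                            ∎
  where open ≤-Reasoning
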